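{- Consider the construction described in the context, with parameters $k$, odd $n$, and rational $0<\alpha\le 0.5$. If $S\subseteq V(G')$ is a set of size at most $k$ such that for every $\{x,y\}\in\mathcal{T}$ there is $w\in S$ with $d(x,w)+d(w,y)\le(1+\alpha)\,d(x,y)$, then for every $i\in[k]$ there is a vertex $w\in S$ that is $H_i$-representative.
   Context: Let $G$ be a graph whose vertex set is partitioned into $V_1,\dots,V_k$ with $V_i=\{v_{i,1},\dots,v_{i,n}\}$, $n$ odd. Fix rational $\alpha$ with $0<\alpha\le 0.5$, and set $L=\lceil n/(2\alpha)\rceil$, $L_p=\lceil (n-1)/\alpha\rceil$. The graph $G'$ (unweighted; $d$ denotes its shortest-path distance) is built as follows: a vertex $b$; for each $i\in[k]$: vertices $u'_{i,1},\dots,u'_{i,n}$ forming a path in this order, vertices $u_{i,1},\dots,u_{i,n}$ forming a path in this order, a vertex $z_i$ adjacent to $u'_{i,1}$ and $u_{i,n}$, a vertex $z'_i$ adjacent to $u'_{i,n}$ and $u_{i,1}$, and a vertex $p_i$ joined to $u_{i,(n+1)/2}$ by a path $P(p_i,u_{i,(n+1)/2})$ with $L_p-1$ new internal vertices; for each $i\in[k]$, $j\in[n]$: a path $P(u_{i,j},b)$ from $u_{i,j}$ to $b$ with $L-1$ new internal vertices, and a path $P(u'_{i,j},b)$ from $u'_{i,j}$ to $b$ with $L-1$ new internal vertices. The terminal set $\mathcal{T}$ consists of $\{p_i,u_{i,(n+1)/2}\}$ for each $i\in[k]$, together with, for all $i<j$ in $[k]$, the set $T_{i,j}=\{\{u'_{i,i'},u'_{j,j'}\}: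 i',j'\in[n],\ v_{i,i'}v_{j,j'}\in E(G)\}$. For $i\in[k]$, a vertex $w\in V(G')$ is called $H_i$-representative if $w\in V(P(p_i,u_{i,(n+1)/2}))$ or $d(u_{i,(n+1)/2},w)\le (n-1)/2$. -}

module Defs where

open import Data.Nat as ℕ using (ℕ; zero; suc; _+_; _*_; _∸_)
open import Data.Fin using (Fin; toℕ)
open import Data.Integer as ℤ using (+_)
open import Data.Rational as ℚ using (ℚ; 0ℚ; 1ℚ; _/_; _÷_; >-nonZero)
open import Data.Product using (Σ; _×_)
open import Relation.Binary.PropositionalEquality using (_≡_)

-- Parameters of the construction
--   k       : number of parts V_1..V_k
--   n       : size of each part (odd); we write n = 2m+1, so that the
--             paper's 1-based middle index (n+1)/2 is the 0-based index m
--             and (n-1)/2 = m.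
--   α       : rational with 0 < α ≤ 1/2

-- L = ⌈ n / (2α) ⌉   (computed as ⌈ (n/2) ÷ α ⌉, the same rational)
Lval : (n : ℕ) (α : ℚ) → 0ℚ ℚ.< α → ℕ
Lval n α pos = ℤ.∣ ℚ.ceiling (((+ n / 2) ÷ α) {{>-nonZero pos}}) ∣

Lpval : (n : ℕ) (α : ℚ) → 0ℚ ℚ.< α → ℕ
Lpval n α pos = ℤ.∣ ℚ.ceiling (((+ (n ∸ 1) / 1) ÷ α) {{>-nonZero pos}}) ∣

toℚ : ℕ → ℚ
toℚ a = + a / 1

-- Indices in Fin are 0-based: u i j is u_{i+1,j+1}.
-- EG is the edge relation of the input graph G on vertices
-- v_{i,j} (i : Fin k, j : Fin n); only pairs from different parts matter.

module Construction (k n m L Lp : ℕ)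
                    (EG : Fin k → Fin n → Fin k → Fin n → Set) where

  data V : Set where
    b    : V
    u'   : Fin k → Fin n → V
    u    : Fin k → Fin n → V
    z    : Fin k → V
    z'   : Fin k → V
    p    : Fin k → V
    -- internal vertices of P(p_i, u_{i,mid}) : L_p - 1 of them
    pint : Fin k → Fin (Lp ∸ 1) → V
    -- internal vertices of P(u_{i,j}, b) and P(u'_{i,j}, b) : L - 1 each
    bu   : Fin k → Fin n → Fin (L ∸ 1) → V
    bu'  : Fin k → Fin n → Fin (L ∸ 1) → V

  data PP (i : Fin k) : ℕ → V → Set where
    pp-start : PP i 0 (p i)
    pp-int   : (t : Fin (Lp ∸ 1)) → PP i (suc (toℕ t)) (pint i t)
    pp-end   : (j : Fin n) → toℕ j ≡ m → PP i Lp (u i j)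

  data PU (i : Fin k) (j : Fin n) : ℕ → V → Set where
    pu-start : PU i j 0 (u i j)
    pu-int   : (t : Fin (L ∸ 1)) → PU i j (suc (toℕ t)) (bu i j t)
    pu-end   : PU i j L b

  data PU' (i : Fin k) (j : Fin n) : ℕ → V → Set where
    pu'-start : PU' i j 0 (u' i j)
    pu'-int   : (t : Fin (L ∸ 1)) → PU' i j (suc (toℕ t)) (bu' i j t)
    pu'-end   : PU' i j L b

  -- (directed presentation of the) edges of G'
  data E : V → V → Set where
    e-u'path : (i : Fin k) (j j' : Fin n) → toℕ j' ≡ suc (toℕ j) → E (u' i j) (u' i j')
    e-upath  : (i : Fin k) (j j' : Fin n) → toℕ j' ≡ suc (toℕ j) → E (u i j) (u i j')
    e-z-u'   : (i : Fin k) (j : Fin n) → toℕ j ≡ 0 → E (z i) (u' i j)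
    e-z-u    : (i : Fin k) (j : Fin n) → toℕ j ≡ n ∸ 1 → E (z i) (u i j)
    e-z'-u'  : (i : Fin k) (j : Fin n) → toℕ j ≡ n ∸ 1 → E (z' i) (u' i j)
    e-z'-u   : (i : Fin k) (j : Fin n) → toℕ j ≡ 0 → E (z' i) (u i j)
    e-p      : (i : Fin k) (t : ℕ) {x y : V} → PP i t x → PP i (suc t) y → E x y
    e-bu     : (i : Fin k) (j : Fin n) (t : ℕ) {x y : V} →
               PU i j t x → PU i j (suc t) y → E x y
    e-bu'    : (i : Fin k) (j : Fin n) (t : ℕ) {x y : V} →
               PU' i j t x → PU' i j (suc t) y → E x y

  data Adj : V → V → Set where
    fwd : {x y : V} → E x y → Adj x y
    bwd : {x y : V} → E y x → Adj x y

  data Walk : V → V → ℕ → Set where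
    w-nil  : {x : V} → Walk x x 0
    w-cons : {x y w : V} {ℓ : ℕ} → Adj x y → Walk y w ℓ → Walk x w (suc ℓ)

  Dist : V → V → ℕ → Set
  Dist x y δ = Walk x y δ × ((ℓ : ℕ) → Walk x y ℓ → δ ℕ.≤ ℓ)

  -- terminal pairs 𝒯 (each unordered pair {x,y} given in one orientation)
  data Terminal : V → V → Set where
    t-p : (i : Fin k) (j : Fin n) → toℕ j ≡ m → Terminal (p i) (u i j)
    t-G : (i j : Fin k) → toℕ i ℕ.< toℕ j → (i' j' : Fin n) →
          EG i i' j j' → Terminal (u' i i') (u' j j')

  data HRep (i : Fin k) (w : V) : Set where
    on-path : (t : ℕ) → PP i t w → HRep i w
    near    : (j : Fin n) → toℕ j ≡ m → (δ : ℕ) → Dist (u i j) w δ →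
              δ ℕ.≤ m → HRep i w

-- Let w ∈ S serve the terminal pair {p_i, u_{i,mid}}, where mid = (n+1)/2.  The path
-- P(p_i, u_{i,mid}) of length L_p meets the rest of G' only in u_{i,mid}, so if w is not on
-- it then d(p_i, w) ≥ L_p + d(u_{i,mid}, w), while d(p_i, u_{i,mid}) ≤ L_p.  The stretch
-- condition then gives L_p + 2 d(u_{i,mid}, w) ≤ (1 + α) L_p, and since L_p ≤ (n-1)/α + 1
-- we get 2 d(u_{i,mid}, w) ≤ α L_p ≤ n - 1 + α ≤ n, i.e. d(u_{i,mid}, w) ≤ (n-1)/2.
-- Distances exist because G' is finite and connected through b: whether a walk of a given
-- length exists is decided over an explicit list of all edges, and a least length is
-- found by search.

{-# OPTIONS --safe #-}
module Submission where

open import Defs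
open import Data.Nat using (ℕ; suc; _+_; _*_; _≤_)
open import Data.Fin using (Fin)
open import Data.Rational as ℚ using (ℚ; 0ℚ; 1ℚ; ½)
open import Data.List using (List; length)
open import Data.List.Membership.Propositional using (_∈_)
open import Data.Product using (Σ; _×_)
open import Relation.Binary.PropositionalEquality using (_≡_)

open import Data.Nat as ℕ using (zero; _∸_; _<_; z≤n; s≤s; _<?_)
import Data.Nat.Properties as ℕ
import Data.Nat.Coprimality as Coprime
import Data.Nat.Tactic.RingSolver as ℕ-Solver
open import Data.Integer as ℤ using (ℤ; +_; +[1+_]; -[1+_])
import Data.Integer.Properties as ℤ
import Data.Integer.DivMod as ℤ
import Data.Integer.Tactic.RingSolver as ℤ-Solver
open import Data.Rational using (mkℚ; ↥_; ↧_; Positive)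
import Data.Rational.Properties as ℚ
import Data.Rational.Unnormalised as ℚᵘ
import Data.Rational.Unnormalised.Properties as ℚᵘ
open import Data.Fin as Fin using (toℕ; fromℕ<)
import Data.Fin.Properties as Fin
open import Data.Unit using (⊤; tt)
import Data.Unit.Properties as ⊤
open import Data.Product as Prod using (∃; _,_; proj₁; proj₂; uncurry)
import Data.Product.Properties as Prod
open import Data.Sum as Sum using (_⊎_; inj₁; inj₂)
import Data.Sum.Properties as Sum
open import Data.List using (_∷_; _++_; map; filter; concat; concatMap; applyUpTo; cartesianProduct; allFin)
open import Data.List.Membership.Propositional using (find; lose)
open import Data.List.Membership.Propositional.Properties
open import Data.List.Relation.Unary.All as All using (All; _∷_)
import Data.List.Relation.Unary.All.Properties as All
open import Data.List.Relation.Unary.Any using (Any; here; there; any?)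
open import Relation.Nullary using (Dec; yes; no; ¬_; contradiction)
import Relation.Nullary.Decidable as Dec
open import Relation.Unary using (Decidable)
open import Relation.Binary.Definitions using (DecidableEquality)
open import Relation.Binary.PropositionalEquality using (refl; sym; trans; cong; cong₂; subst; subst₂; module ≡-Reasoning)

toℚ≡mkℚ : ∀ a → toℚ a ≡ mkℚ (+ a) 0 (Coprime.sym (Coprime.1-coprimeTo a))
toℚ≡mkℚ a = ℚ.normalize-coprime _

toℚ-mono-≤ : ∀ {a c} → a ≤ c → toℚ a ℚ.≤ toℚ c
toℚ-mono-≤ {a} {c} a≤c rewrite toℚ≡mkℚ a | toℚ≡mkℚ c =
  ℚ.*≤* (subst₂ ℤ._≤_ (sym (ℤ.*-identityʳ (+ a))) (sym (ℤ.*-identityʳ (+ c))) (ℤ.+≤+ a≤c))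

toℚ-cancel-≤ : ∀ {a c} → toℚ a ℚ.≤ toℚ c → a ≤ c
toℚ-cancel-≤ {a} {c} le rewrite toℚ≡mkℚ a | toℚ≡mkℚ c =
  ℤ.drop‿+≤+ (subst₂ ℤ._≤_ (ℤ.*-identityʳ (+ a)) (ℤ.*-identityʳ (+ c)) (ℚ.drop-*≤* le))

toℚ-+ : ∀ a c → toℚ (a + c) ≡ toℚ a ℚ.+ toℚ c
toℚ-+ a c rewrite toℚ≡mkℚ a | toℚ≡mkℚ c =
  cong (λ x → x ℚ./ 1) (sym (cong₂ ℤ._+_ (ℤ.*-identityʳ (+ a)) (ℤ.*-identityʳ (+ c))))

private
  -[1+f]D+D≡-fD : ∀ f D → ℤ.- ((+ 1 ℤ.+ f) ℤ.* D) ℤ.+ D ≡ ℤ.- f ℤ.* D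
  -[1+f]D+D≡-fD = ℤ-Solver.solve-∀

  [N*1+1*D]*1≡N+D : ∀ N D → (N ℤ.* + 1 ℤ.+ + 1 ℤ.* D) ℤ.* + 1 ≡ N ℤ.+ D
  [N*1+1*D]*1≡N+D = ℤ-Solver.solve-∀

ceiling-bounds : ∀ q .{{_ : Positive q}} →
                 ↥ q ℤ.≤ ℚ.ceiling q ℤ.* ↧ q × ℚ.ceiling q ℤ.* ↧ q ℤ.< ↥ q ℤ.+ ↧ q
ceiling-bounds (mkℚ +[1+ N ] d _) rewrite ℤ.div-pos-is-/ℕ -[1+ N ] (suc d) {{_}} = lower , upper
  where
  D f : ℤ
  D = + suc d
  f = -[1+ N ] ℤ./ℕ suc d
  lower : +[1+ N ] ℤ.≤ ℤ.- f ℤ.* D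
  lower = subst (+[1+ N ] ℤ.≤_) (ℤ.neg-distribˡ-* f D) (ℤ.neg-mono-≤ (ℤ.[n/ℕd]*d≤n -[1+ N ] (suc d)))
  upper : ℤ.- f ℤ.* D ℤ.< +[1+ N ] ℤ.+ D
  upper = subst (ℤ._< +[1+ N ] ℤ.+ D) (-[1+f]D+D≡-fD f D)
                (ℤ.+-monoˡ-< D (ℤ.neg-mono-< (ℤ.n<s[n/ℕd]*d -[1+ N ] (suc d))))

ceiling-positive : ∀ q .{{_ : Positive q}} → + 0 ℤ.< ℚ.ceiling q
ceiling-positive q@(mkℚ +[1+ _ ] _ _) =
  ℤ.*-cancelʳ-<-nonNeg (↧ q) (ℤ.<-≤-trans (ℤ.+<+ (s≤s z≤n)) (proj₁ (ceiling-bounds q)))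

toℚ≤q+1 : ∀ c q → + c ℤ.* ↧ q ℤ.< ↥ q ℤ.+ ↧ q → toℚ c ℚ.≤ q ℚ.+ 1ℚ
toℚ≤q+1 c q@record{} cD<N+D rewrite toℚ≡mkℚ c =
  ℚ.toℚᵘ-cancel-≤ (ℚᵘ.≤-respʳ-≃ (ℚᵘ.≃-sym (ℚ.toℚᵘ-homo-+ q 1ℚ))
    (ℚᵘ.*≤* (subst₂ ℤ._≤_ (cong (λ d → + c ℤ.* + d) (sym (ℕ.*-identityʳ (ℚ.↧ₙ q))))
                           (sym ([N*1+1*D]*1≡N+D (↥ q) (↧ q)))
                           (ℤ.<⇒≤ cD<N+D))))

pos÷pos : ∀ q α .{{_ : Positive q}} .{{_ : Positive α}} → Positive ((q ℚ.÷ α) {{ℚ.pos⇒nonZero α}})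
pos÷pos q α = ℚ.pos*pos⇒pos q ((ℚ.1/ α) {{ℚ.pos⇒nonZero α}}) {{ℚ.1/pos⇒pos α}}

∣ceiling∣-bounds : ∀ q .{{_ : Positive q}} →
                   1 ≤ ℤ.∣ ℚ.ceiling q ∣ × toℚ ℤ.∣ ℚ.ceiling q ∣ ℚ.≤ q ℚ.+ 1ℚ
∣ceiling∣-bounds q =
    ℤ.drop‿+<+ (subst (+ 0 ℤ.<_) (sym +∣g∣≡g) g>0)
  , toℚ≤q+1 ℤ.∣ ℚ.ceiling q ∣ q
            (subst (λ g → g ℤ.* ↧ q ℤ.< ↥ q ℤ.+ ↧ q) (sym +∣g∣≡g) (proj₂ (ceiling-bounds q)))
  where
  g>0 : + 0 ℤ.< ℚ.ceiling q
  g>0 = ceiling-positive q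
  +∣g∣≡g : + ℤ.∣ ℚ.ceiling q ∣ ≡ ℚ.ceiling q
  +∣g∣≡g = ℤ.0≤i⇒+∣i∣≡i (ℤ.<⇒≤ g>0)

1≤Lval : ∀ n α (pos : 0ℚ ℚ.< α) → 1 ≤ n → 1 ≤ Lval n α pos
1≤Lval n α pos 1≤n = proj₁ (∣ceiling∣-bounds ((+ n ℚ./ 2) ℚ.÷ α))
  where
  instance
    α-positive : Positive α
    α-positive = ℚ.positive pos
    α-nonZero : ℚ.NonZero α
    α-nonZero = ℚ.>-nonZero pos
    q-positive : Positive ((+ n ℚ./ 2) ℚ.÷ α)
    q-positive = pos÷pos (+ n ℚ./ 2) α {{ℚ.normalize-pos n 2 {{_}} {{ℕ.>-nonZero 1≤n}}}}

Lpval-bounds : ∀ n α (pos : 0ℚ ℚ.< α) → 1 ≤ n ∸ 1 →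
               1 ≤ Lpval n α pos ×
               toℚ (Lpval n α pos) ℚ.≤ (toℚ (n ∸ 1) ℚ.÷ α) {{ℚ.>-nonZero pos}} ℚ.+ 1ℚ
Lpval-bounds n α pos 1≤n∸1 = ∣ceiling∣-bounds (toℚ (n ∸ 1) ℚ.÷ α)
  where
  instance
    α-positive : Positive α
    α-positive = ℚ.positive pos
    α-nonZero : ℚ.NonZero α
    α-nonZero = ℚ.>-nonZero pos
    q-positive : Positive (toℚ (n ∸ 1) ℚ.÷ α)
    q-positive = pos÷pos (toℚ (n ∸ 1)) α {{ℚ.normalize-pos (n ∸ 1) 1 {{_}} {{ℕ.>-nonZero 1≤n∸1}}}}

*-÷-cancel : ∀ t α .{{_ : ℚ.NonZero α}} → α ℚ.* (t ℚ.÷ α) ≡ t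
*-÷-cancel t α = begin
  α ℚ.* (t ℚ.* ℚ.1/ α)  ≡⟨ ℚ.*-comm α _ ⟩
  (t ℚ.* ℚ.1/ α) ℚ.* α  ≡⟨ ℚ.*-assoc t _ α ⟩
  t ℚ.* (ℚ.1/ α ℚ.* α)  ≡⟨ cong (t ℚ.*_) (ℚ.*-inverseˡ α) ⟩
  t ℚ.* 1ℚ              ≡⟨ ℚ.*-identityʳ t ⟩
  t                     ∎
  where open ≡-Reasoning

stretch-≤ : ∀ {α} .{{_ : Positive α}} → α ℚ.≤ 1ℚ → ∀ {N X δ s} →
            toℚ X ℚ.≤ (toℚ N ℚ.÷ α) {{ℚ.pos⇒nonZero α}} ℚ.+ 1ℚ → δ ≤ X →
            toℚ s ℚ.≤ (1ℚ ℚ.+ α) ℚ.* toℚ δ → s ≤ X + suc N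
stretch-≤ {α} α≤1 {N} {X} {δ} {s} X≤q+1 δ≤X s≤ = toℚ-cancel-≤ (begin
  toℚ s                         ≤⟨ s≤ ⟩
  (1ℚ ℚ.+ α) ℚ.* toℚ δ          ≤⟨ ℚ.*-monoˡ-≤-nonNeg (1ℚ ℚ.+ α) (toℚ-mono-≤ δ≤X) ⟩
  (1ℚ ℚ.+ α) ℚ.* toℚ X          ≡⟨ ℚ.*-distribʳ-+ (toℚ X) 1ℚ α ⟩
  1ℚ ℚ.* toℚ X ℚ.+ α ℚ.* toℚ X  ≡⟨ cong (ℚ._+ α ℚ.* toℚ X) (ℚ.*-identityˡ (toℚ X)) ⟩
  toℚ X ℚ.+ α ℚ.* toℚ X         ≤⟨ ℚ.+-monoʳ-≤ (toℚ X) αX≤ ⟩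
  toℚ X ℚ.+ toℚ (suc N)         ≡⟨ toℚ-+ X (suc N) ⟨
  toℚ (X + suc N)               ∎)
  where
  open ℚ.≤-Reasoning
  instance
    α-nonZero : ℚ.NonZero α
    α-nonZero = ℚ.pos⇒nonZero α
    α-nonNeg : ℚ.NonNegative α
    α-nonNeg = ℚ.pos⇒nonNeg α
    1+α-nonNeg : ℚ.NonNegative (1ℚ ℚ.+ α)
    1+α-nonNeg = ℚ.nonNeg+nonNeg⇒nonNeg 1ℚ α
  αX≤ : α ℚ.* toℚ X ℚ.≤ toℚ (suc N)
  αX≤ = begin
    α ℚ.* toℚ X                             ≤⟨ ℚ.*-monoˡ-≤-nonNeg α X≤q+1 ⟩
    α ℚ.* (toℚ N ℚ.÷ α ℚ.+ 1ℚ)              ≡⟨ ℚ.*-distribˡ-+ α _ 1ℚ ⟩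
    α ℚ.* (toℚ N ℚ.÷ α) ℚ.+ α ℚ.* 1ℚ        ≡⟨ cong₂ ℚ._+_ (*-÷-cancel (toℚ N) α) (ℚ.*-identityʳ α) ⟩
    toℚ N ℚ.+ α                             ≤⟨ ℚ.+-monoʳ-≤ (toℚ N) α≤1 ⟩
    toℚ N ℚ.+ 1ℚ                            ≡⟨ toℚ-+ N 1 ⟨
    toℚ (N + 1)                             ≡⟨ cong toℚ (ℕ.+-comm N 1) ⟩
    toℚ (suc N)                             ∎

private
  L+2d≡[d+L]+d : ∀ d L → L + 2 * d ≡ (d + L) + d
  L+2d≡[d+L]+d = ℕ-Solver.solve-∀

detour-≤ : ∀ {d L a c m} → d + L ≤ a → d ≤ c → a + c ≤ L + suc (2 * m) → d ≤ m
detour-≤ {d} {L} {a} {c} {m} d+L≤a d≤c a+c≤ = ℕ.s≤s⁻¹ (ℕ.*-cancelˡ-< 2 d (suc m) 2d<2[1+m])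
  where
  2d≤1+2m : 2 * d ≤ suc (2 * m)
  2d≤1+2m = ℕ.+-cancelˡ-≤ L _ _
              (ℕ.≤-trans (ℕ.≤-reflexive (L+2d≡[d+L]+d d L)) (ℕ.≤-trans (ℕ.+-mono-≤ d+L≤a d≤c) a+c≤))
  2d<2[1+m] : 2 * d < 2 * suc m
  2d<2[1+m] = subst (2 * d <_) (sym (ℕ.*-suc 2 m)) (s≤s 2d≤1+2m)

Least : (ℕ → Set) → Set
Least P = Σ ℕ λ δ → P δ × ((ℓ : ℕ) → P ℓ → δ ≤ ℓ)

module _ {P : ℕ → Set} (P? : Decidable P) where

  private
    search : ∀ d f → (∀ {ℓ} → ℓ < d → ¬ P ℓ) → P (f + d) → Least P
    search d f below p with P? d
    ... | yes pd = d , pd , λ ℓ pℓ → ℕ.≮⇒≥ (λ ℓ<d → below ℓ<d pℓ)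
    search d zero    below pd | no ¬pd = contradiction pd ¬pd
    search d (suc f) below p  | no ¬pd = search (suc d) f below′ (subst P (sym (ℕ.+-suc f d)) p)
      where
      below′ : ∀ {ℓ} → ℓ < suc d → ¬ P ℓ
      below′ ℓ<1+d with ℕ.m<1+n⇒m<n∨m≡n ℓ<1+d
      ... | inj₁ ℓ<d  = below ℓ<d
      ... | inj₂ refl = ¬pd

  least : ∀ {n} → P n → Least P
  least {n} pn = search 0 n (λ ()) (subst P (sym (ℕ.+-identityʳ n)) pn)

module Geometry (k n m L Lp : ℕ) (EG : Fin k → Fin n → Fin k → Fin n → Set)
                (mid : Fin n) (mid≡m : toℕ mid ≡ m) (1≤L : 1 ≤ L) (1≤Lp : 1 ≤ Lp) where

  open Construction k n m L Lp EG

  Adj-sym : ∀ {x y} → Adj x y → Adj y x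
  Adj-sym (fwd e) = bwd e
  Adj-sym (bwd e) = fwd e

  infixr 5 _++ʷ_
  _++ʷ_ : ∀ {x y w a c} → Walk x y a → Walk y w c → Walk x w (a + c)
  w-nil        ++ʷ W = W
  w-cons e W₁  ++ʷ W = w-cons e (W₁ ++ʷ W)

  reverseʷ : ∀ {x y a} → Walk x y a → Walk y x a
  reverseʷ w-nil = w-nil
  reverseʷ {a = suc a} (w-cons e W) =
    subst (Walk _ _) (ℕ.+-comm a 1) (reverseʷ W ++ʷ w-cons (Adj-sym e) w-nil)

  private
    Code : Set
    Code = ⊤ ⊎ (Fin k × Fin n) ⊎ (Fin k × Fin n) ⊎ Fin k ⊎ Fin k ⊎ Fin k
         ⊎ (Fin k × Fin (Lp ∸ 1)) ⊎ (Fin k × Fin n × Fin (L ∸ 1)) ⊎ (Fin k × Fin n × Fin (L ∸ 1))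

    encode : V → Code
    encode b            = inj₁ tt
    encode (u' i j)     = inj₂ (inj₁ (i , j))
    encode (u i j)      = inj₂ (inj₂ (inj₁ (i , j)))
    encode (z i)        = inj₂ (inj₂ (inj₂ (inj₁ i)))
    encode (z' i)       = inj₂ (inj₂ (inj₂ (inj₂ (inj₁ i))))
    encode (p i)        = inj₂ (inj₂ (inj₂ (inj₂ (inj₂ (inj₁ i)))))
    encode (pint i t)   = inj₂ (inj₂ (inj₂ (inj₂ (inj₂ (inj₂ (inj₁ (i , t)))))))
    encode (bu i j t)   = inj₂ (inj₂ (inj₂ (inj₂ (inj₂ (inj₂ (inj₂ (inj₁ (i , j , t))))))))
    encode (bu' i j t)  = inj₂ (inj₂ (inj₂ (inj₂ (inj₂ (inj₂ (inj₂ (inj₂ (i , j , t))))))))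

    decode : Code → V
    decode (inj₁ tt) = b
    decode (inj₂ (inj₁ (i , j))) = u' i j
    decode (inj₂ (inj₂ (inj₁ (i , j)))) = u i j
    decode (inj₂ (inj₂ (inj₂ (inj₁ i)))) = z i
    decode (inj₂ (inj₂ (inj₂ (inj₂ (inj₁ i))))) = z' i
    decode (inj₂ (inj₂ (inj₂ (inj₂ (inj₂ (inj₁ i)))))) = p i
    decode (inj₂ (inj₂ (inj₂ (inj₂ (inj₂ (inj₂ (inj₁ (i , t)))))))) = pint i t
    decode (inj₂ (inj₂ (inj₂ (inj₂ (inj₂ (inj₂ (inj₂ (inj₁ (i , j , t))))))))) = bu i j t
    decode (inj₂ (inj₂ (inj₂ (inj₂ (inj₂ (inj₂ (inj₂ (inj₂ (i , j , t))))))))) = bu' i j t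

    decode-encode : ∀ v → decode (encode v) ≡ v
    decode-encode b = refl
    decode-encode (u' i j) = refl
    decode-encode (u i j) = refl
    decode-encode (z i) = refl
    decode-encode (z' i) = refl
    decode-encode (p i) = refl
    decode-encode (pint i t) = refl
    decode-encode (bu i j t) = refl
    decode-encode (bu' i j t) = refl

    infixr 4 _⊎-≟_ _×-≟_
    _⊎-≟_ : ∀ {A B : Set} → DecidableEquality A → DecidableEquality B → DecidableEquality (A ⊎ B)
    _⊎-≟_ = Sum.≡-dec
    _×-≟_ : ∀ {A B : Set} → DecidableEquality A → DecidableEquality B → DecidableEquality (A × B)
    a? ×-≟ b? = Prod.≡-dec a? b?

    _≟ᶜ_ : DecidableEquality Code
    _≟ᶜ_ = ⊤._≟_ ⊎-≟ (Fin._≟_ ×-≟ Fin._≟_) ⊎-≟ (Fin._≟_ ×-≟ Fin._≟_)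
         ⊎-≟ Fin._≟_ ⊎-≟ Fin._≟_ ⊎-≟ Fin._≟_
         ⊎-≟ (Fin._≟_ ×-≟ Fin._≟_)
         ⊎-≟ (Fin._≟_ ×-≟ Fin._≟_ ×-≟ Fin._≟_)
         ⊎-≟ (Fin._≟_ ×-≟ Fin._≟_ ×-≟ Fin._≟_)

  _≟_ : DecidableEquality V
  x ≟ y = Dec.map′ encode-injective (cong encode) (encode x ≟ᶜ encode y)
    where
    encode-injective : encode x ≡ encode y → x ≡ y
    encode-injective e = trans (sym (decode-encode x)) (trans (cong decode e) (decode-encode y))

  data OnPath (len : ℕ) (first last : V) (inner : Fin (len ∸ 1) → V) : ℕ → V → Set where
    on-first : OnPath len first last inner 0 first
    on-inner : (t : Fin (len ∸ 1)) → OnPath len first last inner (suc (toℕ t)) (inner t)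
    on-last  : OnPath len first last inner len last

  module PathFamily {len : ℕ} {first last : V} {inner : Fin (len ∸ 1) → V} (1≤len : 1 ≤ len)
                    (P : ℕ → V → Set)
                    (toOnPath : ∀ {t x} → P t x → OnPath len first last inner t x)
                    (fromOnPath : ∀ {t x} → OnPath len first last inner t x → P t x)
                    (step : ∀ {t x y} → P t x → P (suc t) y → E x y) where

    -- Positions past len are sent to last.
    vertexAt : ℕ → V
    vertexAt zero = first
    vertexAt (suc t) with t <? len ∸ 1
    ... | yes t<len-1 = inner (fromℕ< t<len-1)
    ... | no  _       = last

    private
      len≡1+[len-1] : len ≡ suc (len ∸ 1)
      len≡1+[len-1] = sym (ℕ.m+[n∸m]≡n 1≤len)

      vertexAt-beyond : ∀ {t} → len ∸ 1 ≤ t → vertexAt (suc t) ≡ last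
      vertexAt-beyond {t} len-1≤t with t <? len ∸ 1
      ... | yes lt = contradiction lt (ℕ.≤⇒≯ len-1≤t)
      ... | no  _  = refl

      vertexAt-len : vertexAt len ≡ last
      vertexAt-len = trans (cong vertexAt len≡1+[len-1]) (vertexAt-beyond ℕ.≤-refl)

      OnPath⇒vertexAt : ∀ {t x} → OnPath len first last inner t x → x ≡ vertexAt t
      OnPath⇒vertexAt on-first = refl
      OnPath⇒vertexAt (on-inner t) with toℕ t <? len ∸ 1
      ... | yes lt = cong inner (sym (Fin.fromℕ<-toℕ t lt))
      ... | no ¬lt = contradiction (Fin.toℕ<n t) ¬lt
      OnPath⇒vertexAt on-last = sym vertexAt-len

      OnPath-vertexAt : ∀ {t} → t ≤ len → OnPath len first last inner t (vertexAt t)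
      OnPath-vertexAt {zero} _ = on-first
      OnPath-vertexAt {suc t} 1+t≤len with t <? len ∸ 1
      ... | yes lt = subst (λ s → OnPath len first last inner (suc s) (inner (fromℕ< lt)))
                           (Fin.toℕ-fromℕ< lt) (on-inner (fromℕ< lt))
      ... | no ¬lt = subst (λ s → OnPath len first last inner s last) (sym 1+t≡len) on-last
        where
        1+t≡len : suc t ≡ len
        1+t≡len = ℕ.≤-antisym 1+t≤len (ℕ.≤-trans (ℕ.≤-reflexive len≡1+[len-1]) (s≤s (ℕ.≮⇒≥ ¬lt)))

    position≤len : ∀ {t x} → P t x → t ≤ len
    position≤len a with toOnPath a
    ... | on-first   = z≤n
    ... | on-inner t = ℕ.≤-trans (Fin.toℕ<n t) (ℕ.m∸n≤m len 1)
    ... | on-last    = ℕ.≤-refl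

    P⇒vertexAt : ∀ {t x} → P t x → x ≡ vertexAt t
    P⇒vertexAt a = OnPath⇒vertexAt (toOnPath a)

    P-vertexAt : ∀ {t} → t ≤ len → P t (vertexAt t)
    P-vertexAt t≤len = fromOnPath (OnPath-vertexAt t≤len)

    P-functional : ∀ {t x y} → P t x → P t y → x ≡ y
    P-functional a a′ = trans (P⇒vertexAt a) (sym (P⇒vertexAt a′))

    steps : List (V × V)
    steps = applyUpTo (λ t → vertexAt t , vertexAt (suc t)) len

    ∈-steps : ∀ {t x y} → P t x → P (suc t) y → (x , y) ∈ steps
    ∈-steps a a′ rewrite P⇒vertexAt a | P⇒vertexAt a′ = ∈-applyUpTo⁺ _ (position≤len a′)

    steps-sound : All (uncurry E) steps
    steps-sound = All.applyUpTo⁺₁ _ len (λ t<len → step (P-vertexAt (ℕ.<⇒≤ t<len)) (P-vertexAt t<len))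

    walk-to-last : ∀ {t x} → P t x → Walk x last (len ∸ t)
    walk-to-last {t} a = go (len ∸ t) (ℕ.m+[n∸m]≡n (position≤len a)) a
      where
      go : ∀ d {s x} → s + d ≡ len → P s x → Walk x last d
      go zero {s} s+0≡len a = subst (λ y → Walk _ y 0) (P-functional a P-last) w-nil
        where
        P-last : P s last
        P-last = fromOnPath (subst (λ r → OnPath len first last inner r last)
                                   (sym (trans (sym (ℕ.+-identityʳ s)) s+0≡len)) on-last)
      go (suc d) {s} s+1+d≡len a = w-cons (fwd (step a a′)) (go d (trans (sym (ℕ.+-suc s d)) s+1+d≡len) a′)
        where
        a′ : P (suc s) (vertexAt (suc s))
        a′ = P-vertexAt (subst (suc s ≤_) s+1+d≡len (ℕ.m<m+n s (s≤s z≤n)))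

  PP⇒OnPath : ∀ {i t x} → PP i t x → OnPath Lp (p i) (u i mid) (pint i) t x
  PP⇒OnPath pp-start     = on-first
  PP⇒OnPath (pp-int t)   = on-inner t
  PP⇒OnPath (pp-end j e) rewrite Fin.toℕ-injective (trans e (sym mid≡m)) = on-last

  OnPath⇒PP : ∀ {i t x} → OnPath Lp (p i) (u i mid) (pint i) t x → PP i t x
  OnPath⇒PP on-first     = pp-start
  OnPath⇒PP (on-inner t) = pp-int t
  OnPath⇒PP on-last      = pp-end mid mid≡m

  PU⇒OnPath : ∀ {i j t x} → PU i j t x → OnPath L (u i j) b (bu i j) t x
  PU⇒OnPath pu-start   = on-first
  PU⇒OnPath (pu-int t) = on-inner t
  PU⇒OnPath pu-end     = on-last

  OnPath⇒PU : ∀ {i j t x} → OnPath L (u i j) b (bu i j) t x → PU i j t x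
  OnPath⇒PU on-first     = pu-start
  OnPath⇒PU (on-inner t) = pu-int t
  OnPath⇒PU on-last      = pu-end

  PU'⇒OnPath : ∀ {i j t x} → PU' i j t x → OnPath L (u' i j) b (bu' i j) t x
  PU'⇒OnPath pu'-start   = on-first
  PU'⇒OnPath (pu'-int t) = on-inner t
  PU'⇒OnPath pu'-end     = on-last

  OnPath⇒PU' : ∀ {i j t x} → OnPath L (u' i j) b (bu' i j) t x → PU' i j t x
  OnPath⇒PU' on-first     = pu'-start
  OnPath⇒PU' (on-inner t) = pu'-int t
  OnPath⇒PU' on-last      = pu'-end

  module PPath (i : Fin k) = PathFamily 1≤Lp (PP i) PP⇒OnPath OnPath⇒PP (e-p i _)
  module UPath (i : Fin k) (j : Fin n) = PathFamily 1≤L (PU i j) PU⇒OnPath OnPath⇒PU (e-bu i j _)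
  module U'Path (i : Fin k) (j : Fin n) = PathFamily 1≤L (PU' i j) PU'⇒OnPath OnPath⇒PU' (e-bu' i j _)

  consecutive? : Decidable (λ ((j , j′) : Fin n × Fin n) → toℕ j′ ≡ suc (toℕ j))
  consecutive? (j , j′) = toℕ j′ ℕ.≟ suc (toℕ j)

  consecutive : List (Fin n × Fin n)
  consecutive = filter consecutive? (cartesianProduct (allFin n) (allFin n))

  rowSteps : (Fin n → V) → List (V × V)
  rowSteps f = map (Prod.map f f) consecutive

  ∈-rowSteps : ∀ f {j j′} → toℕ j′ ≡ suc (toℕ j) → (f j , f j′) ∈ rowSteps f
  ∈-rowSteps f j′≡1+j =
    ∈-map⁺ (Prod.map f f) (∈-filter⁺ _ (∈-cartesianProduct⁺ (∈-allFin _) (∈-allFin _)) j′≡1+j)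

  rowSteps-sound : ∀ {f} → (∀ {j j′} → toℕ j′ ≡ suc (toℕ j) → E (f j) (f j′)) →
                   All (uncurry E) (rowSteps f)
  rowSteps-sound step = All.map⁺ (All.map step (All.all-filter consecutive? (cartesianProduct (allFin n) (allFin n))))

  spokes : V → (Fin n → V) → ℕ → List (V × V)
  spokes c f r = map (λ j → c , f j) (filter (λ j → toℕ j ℕ.≟ r) (allFin n))

  ∈-spokes : ∀ {c f r j} → toℕ j ≡ r → (c , f j) ∈ spokes c f r
  ∈-spokes {c} {f} j≡r = ∈-map⁺ (λ j → c , f j) (∈-filter⁺ _ (∈-allFin _) j≡r)

  spokes-sound : ∀ {c f r} → (∀ {j} → toℕ j ≡ r → E c (f j)) → All (uncurry E) (spokes c f r)
  spokes-sound {r = r} edge = All.map⁺ (All.map edge (All.all-filter (λ j → toℕ j ℕ.≟ r) (allFin n)))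

  edgeGroups : Fin k → List (List (V × V))
  edgeGroups i = rowSteps (u' i) ∷ rowSteps (u i)
               ∷ spokes (z i) (u' i) 0 ∷ spokes (z i) (u i) (n ∸ 1)
               ∷ spokes (z' i) (u' i) (n ∸ 1) ∷ spokes (z' i) (u i) 0
               ∷ PPath.steps i
               ∷ map (UPath.steps i) (allFin n) ++ map (U'Path.steps i) (allFin n)

  edges : List (V × V)
  edges = concat (concatMap edgeGroups (allFin k))

  edges-sound : All (uncurry E) edges
  edges-sound = All.concat⁺ (All.concat⁺ (All.map⁺ (All.tabulate {xs = allFin k} (λ {i} _ → edgeGroups-sound i))))
    where
    edgeGroups-sound : ∀ i → All (All (uncurry E)) (edgeGroups i)
    edgeGroups-sound i =
        rowSteps-sound (e-u'path i _ _) ∷ rowSteps-sound (e-upath i _ _)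
      ∷ spokes-sound (e-z-u' i _) ∷ spokes-sound (e-z-u i _)
      ∷ spokes-sound (e-z'-u' i _) ∷ spokes-sound (e-z'-u i _)
      ∷ PPath.steps-sound i
      ∷ All.++⁺ (All.map⁺ (All.tabulate {xs = allFin n} (λ {j} _ → UPath.steps-sound i j)))
                (All.map⁺ (All.tabulate {xs = allFin n} (λ {j} _ → U'Path.steps-sound i j)))

  private
    inGroup : ∀ i {e g} → g ∈ edgeGroups i → e ∈ g → e ∈ edges
    inGroup i g∈ e∈ = ∈-concat⁺′ e∈ (∈-concatMap⁺ edgeGroups (lose (∈-allFin i) g∈))

  E⇒∈edges : ∀ {x y} → E x y → (x , y) ∈ edges
  E⇒∈edges (e-u'path i j j′ e) = inGroup i (here refl) (∈-rowSteps (u' i) e)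
  E⇒∈edges (e-upath i j j′ e)  = inGroup i (there (here refl)) (∈-rowSteps (u i) e)
  E⇒∈edges (e-z-u' i j e)      = inGroup i (there (there (here refl))) (∈-spokes e)
  E⇒∈edges (e-z-u i j e)       = inGroup i (there (there (there (here refl)))) (∈-spokes e)
  E⇒∈edges (e-z'-u' i j e)     = inGroup i (there (there (there (there (here refl))))) (∈-spokes e)
  E⇒∈edges (e-z'-u i j e)      = inGroup i (there (there (there (there (there (here refl)))))) (∈-spokes e)
  E⇒∈edges (e-p i t a a′)      =
    inGroup i (there (there (there (there (there (there (here refl))))))) (PPath.∈-steps i a a′)
  E⇒∈edges (e-bu i j t a a′)   =
    inGroup i (there (there (there (there (there (there (there (∈-++⁺ˡ (∈-map⁺ _ (∈-allFin j))))))))))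
            (UPath.∈-steps i j a a′)
  E⇒∈edges (e-bu' i j t a a′)  =
    inGroup i (there (there (there (there (there (there (there (∈-++⁺ʳ _ (∈-map⁺ _ (∈-allFin j))))))))))
            (U'Path.∈-steps i j a a′)

  ∈edges⇒E : ∀ {x y} → (x , y) ∈ edges → E x y
  ∈edges⇒E = All.lookup edges-sound

  walk? : ∀ ℓ x y → Dec (Walk x y ℓ)
  walk? zero x y = Dec.map′ (λ { refl → w-nil }) (λ { w-nil → refl }) (x ≟ y)
  walk? (suc ℓ) x y = Dec.map′ from to (any? step? edges)
    where
    Step : V × V → Set
    Step (s , t) = (s ≡ x × Walk t y ℓ) ⊎ (t ≡ x × Walk s y ℓ)

    step? : Decidable Step
    step? (s , t) = ((s ≟ x) Dec.×-dec walk? ℓ t y) Dec.⊎-dec ((t ≟ x) Dec.×-dec walk? ℓ s y)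

    from : Any Step edges → Walk x y (suc ℓ)
    from st with find st
    ... | _ , st∈ , inj₁ (refl , W) = w-cons (fwd (∈edges⇒E st∈)) W
    ... | _ , st∈ , inj₂ (refl , W) = w-cons (bwd (∈edges⇒E st∈)) W

    to : Walk x y (suc ℓ) → Any Step edges
    to (w-cons (fwd e) W) = lose (E⇒∈edges e) (inj₁ (refl , W))
    to (w-cons (bwd e) W) = lose (E⇒∈edges e) (inj₂ (refl , W))

  distance : ∀ {x y ℓ} → Walk x y ℓ → Σ ℕ (Dist x y)
  distance {x} {y} = least (λ ℓ → walk? ℓ x y)

  private
    first : Fin n
    first = fromℕ< (ℕ.≤-<-trans z≤n (Fin.toℕ<n mid))

    toℕ-first : toℕ first ≡ 0
    toℕ-first = Fin.toℕ-fromℕ< _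

  walk-to-b : ∀ v → Σ ℕ (Walk v b)
  walk-to-b b            = _ , w-nil
  walk-to-b (u' i j)     = _ , U'Path.walk-to-last i j pu'-start
  walk-to-b (u i j)      = _ , UPath.walk-to-last i j pu-start
  walk-to-b (z i)        = _ , w-cons (fwd (e-z-u' i first toℕ-first)) (U'Path.walk-to-last i first pu'-start)
  walk-to-b (z' i)       = _ , w-cons (fwd (e-z'-u i first toℕ-first)) (UPath.walk-to-last i first pu-start)
  walk-to-b (p i)        = _ , PPath.walk-to-last i pp-start ++ʷ UPath.walk-to-last i mid pu-start
  walk-to-b (pint i t)   = _ , PPath.walk-to-last i (pp-int t) ++ʷ UPath.walk-to-last i mid pu-start
  walk-to-b (bu i j t)   = _ , UPath.walk-to-last i j (pu-int t)
  walk-to-b (bu' i j t)  = _ , U'Path.walk-to-last i j (pu'-int t)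

  dist : ∀ x y → Σ ℕ (Dist x y)
  dist x y = distance (proj₂ (walk-to-b x) ++ʷ reverseʷ (proj₂ (walk-to-b y)))

  PP-neighbour : ∀ {i t v y} → t < Lp → PP i t v → Adj v y →
                 PP i (suc t) y ⊎ ∃ λ t′ → t ≡ suc t′ × PP i t′ y
  PP-neighbour _ pp-start (fwd (e-p _ _ pp-start a′))  = inj₁ a′
  PP-neighbour _ pp-start (fwd (e-bu _ _ _ () _))
  PP-neighbour _ pp-start (fwd (e-bu' _ _ _ () _))
  PP-neighbour _ pp-start (bwd (e-p _ _ _ ()))
  PP-neighbour _ pp-start (bwd (e-bu _ _ _ _ ()))
  PP-neighbour _ pp-start (bwd (e-bu' _ _ _ _ ()))
  PP-neighbour _ (pp-int t) (fwd (e-p _ _ (pp-int .t) a′)) = inj₁ a′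
  PP-neighbour _ (pp-int t) (fwd (e-bu _ _ _ () _))
  PP-neighbour _ (pp-int t) (fwd (e-bu' _ _ _ () _))
  PP-neighbour _ (pp-int t) (bwd (e-p _ _ a′ (pp-int .t))) = inj₂ (_ , refl , a′)
  PP-neighbour _ (pp-int t) (bwd (e-bu _ _ _ _ ()))
  PP-neighbour _ (pp-int t) (bwd (e-bu' _ _ _ _ ()))
  PP-neighbour t<Lp (pp-end _ _) _ = contradiction t<Lp (ℕ.<-irrefl refl)

  OnPPathOrPast : Fin k → V → ℕ → Set
  OnPPathOrPast i w bound = (∃ λ s → PP i s w) ⊎ (∃ λ ℓ′ → Walk (u i mid) w ℓ′ × ℓ′ + Lp ≤ bound)

  private
    weaken : ∀ {i w bound bound′} → bound ≤ bound′ → OnPPathOrPast i w bound → OnPPathOrPast i w bound′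
    weaken bound≤ = Sum.map₂ (Prod.map₂ (Prod.map₂ (λ le → ℕ.≤-trans le bound≤)))

  -- A walk from position t reaches u_{i,mid} only after covering the remaining Lp - t steps.
  leave-pPath : ∀ {i t v w ℓ} → t < Lp → PP i t v → Walk v w ℓ → OnPPathOrPast i w (ℓ + t)
  leave-pPath _ a w-nil = inj₁ (_ , a)
  leave-pPath {i} {t} {ℓ = suc ℓ} t<Lp a (w-cons {y = y} e W) with PP-neighbour t<Lp a e
  ... | inj₂ (t′ , refl , a′) =
    weaken (ℕ.+-mono-≤ (ℕ.n≤1+n ℓ) (ℕ.n≤1+n t′)) (leave-pPath (ℕ.<-trans (ℕ.n<1+n t′) t<Lp) a′ W)
  ... | inj₁ a′ with suc t <? Lp
  ...   | yes 1+t<Lp = weaken (ℕ.≤-reflexive (ℕ.+-suc ℓ t)) (leave-pPath 1+t<Lp a′ W)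
  ...   | no  1+t≮Lp =
    inj₂ (ℓ , subst (λ y → Walk y _ ℓ) y≡u W , ℕ.≤-reflexive (trans (cong (_+_ ℓ) (sym 1+t≡Lp)) (ℕ.+-suc ℓ t)))
    where
    1+t≡Lp : suc t ≡ Lp
    1+t≡Lp = ℕ.≤-antisym t<Lp (ℕ.≮⇒≥ 1+t≮Lp)
    y≡u : y ≡ u i mid
    y≡u = PPath.P-functional i a′ (subst (λ s → PP i s (u i mid)) (sym 1+t≡Lp) (pp-end mid mid≡m))

  on-pPath-or-past-mid : ∀ {i w a} → Walk (p i) w a →
                         (∃ λ s → PP i s w) ⊎ (∃ λ δ′ → Dist (u i mid) w δ′ × δ′ + Lp ≤ a)
  on-pPath-or-past-mid {a = a} W with leave-pPath 1≤Lp pp-start W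
  ... | inj₁ on = inj₁ on
  ... | inj₂ (ℓ′ , W′ , ℓ′+Lp≤a+0) with distance W′
  ...   | δ′ , d[u,w] = inj₂ (δ′ , d[u,w] , ℕ.≤-trans (ℕ.+-monoˡ-≤ Lp (proj₂ d[u,w] ℓ′ W′))
                                                     (subst (ℓ′ + Lp ≤_) (ℕ.+-identityʳ a) ℓ′+Lp≤a+0))

  stretched-midpoint⇒HRep : ∀ {α} .{{_ : Positive α}} → α ℚ.≤ 1ℚ →
    toℚ Lp ℚ.≤ (toℚ (2 * m) ℚ.÷ α) {{ℚ.pos⇒nonZero α}} ℚ.+ 1ℚ → ∀ {i w} →
    ((a c δ : ℕ) → Dist (p i) w a → Dist w (u i mid) c → Dist (p i) (u i mid) δ →
      toℚ (a + c) ℚ.≤ (1ℚ ℚ.+ α) ℚ.* toℚ δ) →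
    HRep i w
  stretched-midpoint⇒HRep α≤1 Lp≤ {i} {w} stretch
    with dist (p i) w | dist w (u i mid) | dist (p i) (u i mid)
  ... | a , d[p,w] | c , d[w,u] | δ , d[p,u] with on-pPath-or-past-mid (proj₁ d[p,w])
  ...   | inj₁ (s , on) = on-path s on
  ...   | inj₂ (δ′ , d[u,w] , δ′+Lp≤a) = near mid mid≡m δ′ d[u,w] (detour-≤ δ′+Lp≤a δ′≤c a+c≤)
    where
    δ′≤c : δ′ ≤ c
    δ′≤c = proj₂ d[u,w] c (reverseʷ (proj₁ d[w,u]))
    δ≤Lp : δ ≤ Lp
    δ≤Lp = proj₂ d[p,u] Lp (PPath.walk-to-last i pp-start)
    a+c≤ : a + c ≤ Lp + suc (2 * m)
    a+c≤ = stretch-≤ α≤1 Lp≤ δ≤Lp (stretch a c δ d[p,w] d[w,u] d[p,u])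

lemma5 : (k m : ℕ) → 1 ≤ m → (n : ℕ) → n ≡ 2 * m + 1 →
         (α : ℚ) → (pos : 0ℚ ℚ.< α) → α ℚ.≤ ½ →
         (EG : Fin k → Fin n → Fin k → Fin n → Set) →
         let open Construction k n m (Lval n α pos) (Lpval n α pos) EG in
         (S : List V) → length S ≤ k →
         ((x y : V) → Terminal x y →
           Σ V (λ w → w ∈ S × ((a c δ : ℕ) → Dist x w a → Dist w y c →
             Dist x y δ → toℚ (a + c) ℚ.≤ (1ℚ ℚ.+ α) ℚ.* toℚ δ))) →
         (i : Fin k) → Σ V (λ w → w ∈ S × HRep i w)
lemma5 k m 1≤m n n≡2m+1 α 0<α α≤½ EG S _ covered i =
  let w , w∈S , stretch = covered (p i) (u i mid) (t-p i mid mid≡m)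
  in  w , w∈S , stretched-midpoint⇒HRep α≤1 Lp≤ stretch
  where
  open Construction k n m (Lval n α 0<α) (Lpval n α 0<α) EG

  n∸1≡2m : n ∸ 1 ≡ 2 * m
  n∸1≡2m = trans (cong (_∸ 1) n≡2m+1) (ℕ.m+n∸n≡m (2 * m) 1)

  m<n : m < n
  m<n = subst (m <_) (sym (trans n≡2m+1 (ℕ.+-comm (2 * m) 1))) (s≤s (ℕ.m≤m+n m (m + 0)))

  mid : Fin n
  mid = fromℕ< m<n

  mid≡m : toℕ mid ≡ m
  mid≡m = Fin.toℕ-fromℕ< m<n

  instance
    α-positive : Positive α
    α-positive = ℚ.positive 0<α
    α-nonZero : ℚ.NonZero α
    α-nonZero = ℚ.>-nonZero 0<α

  1≤n∸1 : 1 ≤ n ∸ 1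
  1≤n∸1 = subst (1 ≤_) (sym n∸1≡2m) (ℕ.≤-trans 1≤m (ℕ.m≤m+n m (m + 0)))

  Lp≤ : toℚ (Lpval n α 0<α) ℚ.≤ toℚ (2 * m) ℚ.÷ α ℚ.+ 1ℚ
  Lp≤ = subst (λ N → toℚ (Lpval n α 0<α) ℚ.≤ toℚ N ℚ.÷ α ℚ.+ 1ℚ) n∸1≡2m
              (proj₂ (Lpval-bounds n α 0<α 1≤n∸1))

  open Geometry k n m (Lval n α 0<α) (Lpval n α 0<α) EG mid mid≡m
                (1≤Lval n α 0<α (ℕ.≤-<-trans z≤n m<n)) (proj₁ (Lpval-bounds n α 0<α 1≤n∸1))

  α≤1 : α ℚ.≤ 1ℚ
  α≤1 = ℚ.≤-trans α≤½ (ℚ.*≤* (ℤ.+≤+ (s≤s z≤n)))
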